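{- Let $d$ be a non-negative real number and $n$ a positive integer. If $G$ is a balanced bipartite graph with partite sets $A$ and $B$, $|A|=|B|=n$ (so $G$ has order $2n$), and $G$ has at most $dn$ edges, then $\tilde{\alpha}(G)\geq \frac{n}{d+1}-2$.
   Context: All graphs are finite, simple and undirected. A bipartite graph $G$ is always considered with a fixed bipartition into partite sets $A$ and $B$; it is balanced if $|A|=|B|$. A bihole of order $k$ in $G$ is an independent set $I$ of $G$ with $|I\cap A|=|I\cap B|=k$. $\tilde{\alpha}(G)$ denotes the largest order of a bihole in $G$.
   Formalization: The parameter d ranges over the non-negative rationals rather than the non-negative reals. -}

module Defs where

open import Data.Bool using (Bool; true; false)
open import Data.Nat using (ℕ)
open import Data.Integer using (+_)
open import Data.Fin using (Fin)
open import Data.Fin.Subset using (Subset; _∈_; ∣_∣)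
open import Data.Vec using (tabulate; count)
open import Data.Vec.Functional using () renaming (foldr to vfoldr)
open import Data.Product using (Σ; _×_; _,_)
open import Relation.Binary.PropositionalEquality using (_≡_)
open import Relation.Nullary using (¬_)
open import Data.Rational using (ℚ; 0ℚ; 1ℚ; _+_; _-_; _*_; _÷_; _/_; _≤_; Positive; NonNegative; nonNegative)
open import Data.Rational.Properties using (nonNeg+pos⇒pos; pos⇒nonZero)
import Data.Nat as ℕ

-- A bipartite graph with fixed partite sets A = Fin n and B = Fin n
-- (a balanced bipartite graph of order 2n). Edges only go between A and B;
-- adj a b = true iff a ∈ A is adjacent to b ∈ B.
record BalancedBipartite (n : ℕ) : Set where
  field
    adj : Fin n → Fin n → Bool
open BalancedBipartite public

edgeCount : ∀ {n} → BalancedBipartite n → ℕ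
edgeCount {n} G = vfoldr ℕ._+_ 0 (λ a → count (Data.Bool._≟ true) (tabulate (adj G a)))
  where import Data.Bool

-- (S , T) with S ⊆ A, T ⊆ B is independent: no edge between S and T
-- (within A and within B there are no edges at all).
Independent : ∀ {n} → BalancedBipartite n → Subset n → Subset n → Set
Independent G S T = ∀ a b → a ∈ S → b ∈ T → adj G a b ≡ false

Bihole : ∀ {n} → BalancedBipartite n → ℕ → Set
Bihole {n} G k = Σ (Subset n) λ S → Σ (Subset n) λ T →
  Independent G S T × ∣ S ∣ ≡ k × ∣ T ∣ ≡ k

-- α̃(G) ≥ x  (x rational): there is a bihole of order k with k ≥ x.
-- Since α̃(G) is the largest order of a bihole, this is its unfolding.
αtilde≥ : ∀ {n} → BalancedBipartite n → ℚ → Set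
αtilde≥ G x = Σ ℕ λ k → Bihole G k × x ≤ (+ k / 1)

ℕtoℚ : ℕ → ℚ
ℕtoℚ k = + k / 1

bound : (n : ℕ) (d : ℚ) → 0ℚ ≤ d → ℚ
bound n d 0≤d = (ℕtoℚ n ÷ (d + 1ℚ)) {{nz}} - ℕtoℚ 2
  where
    instance _ : NonNegative d
             _ = nonNegative 0≤d
    pos : Positive (d + 1ℚ)
    pos = nonNeg+pos⇒pos d 1ℚ
    nz = pos⇒nonZero (d + 1ℚ) {{pos}}

-- Average the degrees: among the vertices of A, some k of them have total
-- degree at most k E / n (E the number of edges), so their neighbourhood in B
-- has at most k E / n vertices. If k (n + E) ≤ n², that leaves at least k
-- vertices of B outside it, and these together with the k chosen vertices of A
-- form a bihole of order k. The largest such k is ⌊n² / (n + E)⌋, and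
-- E ≤ d n gives ⌊n² / (n + E)⌋ + 1 > n / (d + 1).
module Submission where

module Counting where
  open import Data.Nat
  open import Data.Nat.Properties
  open import Data.Nat.DivMod using (_/_; _%_; m≡m%n+[m/n]*n; m%n<n)
  open import Data.Nat.Solver using (module +-*-Solver)
  open import Data.Fin using (Fin; zero; suc)
  open import Data.Fin.Subset using (Subset; _∈_; _⊆_; _∪_; ∁; ∣_∣; ⊥; ⊤; inside; outside)
  open import Data.Fin.Subset.Properties
    using (⊥⊆; ∣⊥∣≡0; ∣⊤∣≡n; p⊆p∪q; q⊆p∪q; in⊆in; out⊆; x∈∁p⇒x∉p; ∣∁p∣≡n∸∣p∣)
  open import Data.Vec using ([]; _∷_; here; there; tabulate)
  open import Data.Vec.Properties using (lookup⇒[]=; lookup∘tabulate)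
  open import Data.Vec.Functional using () renaming (foldr to vfoldr)
  open import Data.Bool using (true; false)
  open import Data.Product using (Σ-syntax; _×_; _,_)
  open import Data.Sum using (inj₁; inj₂)
  open import Data.Empty using (⊥-elim)
  open import Function using (_∘_)
  open import Relation.Binary.PropositionalEquality
  open import Relation.Nullary using (yes; no)
  open import Defs
  open +-*-Solver

  sum : ∀ {p} → (Fin p → ℕ) → ℕ
  sum = vfoldr _+_ 0

  sumOver : ∀ {p} → Subset p → (Fin p → ℕ) → ℕ
  sumOver []            f = 0
  sumOver (inside ∷ S)  f = f zero + sumOver S (f ∘ suc)
  sumOver (outside ∷ S) f = sumOver S (f ∘ suc)

  sumOver-⊥ : ∀ {p} (f : Fin p → ℕ) → sumOver ⊥ f ≡ 0
  sumOver-⊥ {zero}  f = refl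
  sumOver-⊥ {suc p} f = sumOver-⊥ (f ∘ suc)

  sumOver-⊤ : ∀ {p} (f : Fin p → ℕ) → sumOver ⊤ f ≡ sum f
  sumOver-⊤ {zero}  f = refl
  sumOver-⊤ {suc p} f = cong (f zero +_) (sumOver-⊤ (f ∘ suc))

  -- Multiplied out by q = j + r, the slack is r (E − q x) ≥ 0.
  ≤-average-with-head : ∀ q j x E s .{{_ : NonZero q}} → j ≤ q → q * x ≤ E →
                        q * s ≤ j * E → suc q * (x + s) ≤ suc j * (x + E)
  ≤-average-with-head q j x E s j≤q qx≤E qs≤jE with m≤n⇒∃[o]m+o≡n j≤q
  ... | r , refl = *-cancelˡ-≤ (j + r) (begin
      (j + r) * (suc (j + r) * (x + s))
        ≡⟨ solve 4 (λ j r x s → (j :+ r) :* ((con 1 :+ (j :+ r)) :* (x :+ s))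
             := (j :+ r) :* (con 1 :+ (j :+ r)) :* x :+ (con 1 :+ (j :+ r)) :* ((j :+ r) :* s)) refl j r x s ⟩
      (j + r) * suc (j + r) * x + suc (j + r) * ((j + r) * s)
        ≤⟨ +-monoʳ-≤ ((j + r) * suc (j + r) * x) (*-monoʳ-≤ (suc (j + r)) qs≤jE) ⟩
      (j + r) * suc (j + r) * x + suc (j + r) * (j * E)
        ≡⟨ solve 4 (λ j r x e → (j :+ r) :* (con 1 :+ (j :+ r)) :* x :+ (con 1 :+ (j :+ r)) :* (j :* e)
             := (j :+ r) :* (con 1 :+ j) :* x :+ j :* (con 1 :+ (j :+ r)) :* e :+ r :* ((j :+ r) :* x)) refl j r x E ⟩
      (j + r) * suc j * x + j * suc (j + r) * E + r * ((j + r) * x)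
        ≤⟨ +-monoʳ-≤ ((j + r) * suc j * x + j * suc (j + r) * E) (*-monoʳ-≤ r qx≤E) ⟩
      (j + r) * suc j * x + j * suc (j + r) * E + r * E
        ≡⟨ solve 4 (λ j r x e → (j :+ r) :* (con 1 :+ j) :* x :+ j :* (con 1 :+ (j :+ r)) :* e :+ r :* e
             := (j :+ r) :* ((con 1 :+ j) :* (x :+ e))) refl j r x E ⟩
      (j + r) * (suc j * (x + E)) ∎)
    where open ≤-Reasoning

  ≤-average-without-head : ∀ q k x E s .{{_ : NonZero q}} → E ≤ q * x →
                           q * s ≤ k * E → suc q * s ≤ k * (x + E)
  ≤-average-without-head q k x E s E≤qx qs≤kE = *-cancelˡ-≤ q (begin
      q * (suc q * s)      ≡⟨ solve 2 (λ q s → q :* ((con 1 :+ q) :* s) := (con 1 :+ q) :* (q :* s)) refl q s ⟩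
      suc q * (q * s)      ≤⟨ *-monoʳ-≤ (suc q) qs≤kE ⟩
      suc q * (k * E)      ≡⟨ solve 3 (λ q k e → (con 1 :+ q) :* (k :* e) := k :* (q :* e) :+ k :* e) refl q k E ⟩
      k * (q * E) + k * E  ≤⟨ +-monoʳ-≤ (k * (q * E)) (*-monoʳ-≤ k E≤qx) ⟩
      k * (q * E) + k * (q * x)
        ≡⟨ solve 4 (λ q k e x → k :* (q :* e) :+ k :* (q :* x) := q :* (k :* (x :+ e))) refl q k E x ⟩
      q * (k * (x + E))    ∎)
    where open ≤-Reasoning

  -- Keep the first element when it is at most the average of the others.
  light-subset : ∀ {p} (f : Fin p → ℕ) {k} → k ≤ p →
                 Σ[ S ∈ Subset p ] ∣ S ∣ ≡ k × p * sumOver S f ≤ k * sum f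
  light-subset {p} f {zero} _ =
    ⊥ , ∣⊥∣≡0 p , ≤-reflexive (trans (cong (p *_) (sumOver-⊥ f)) (*-zeroʳ p))
  light-subset {suc q} f {suc j} (s≤s j≤q) with m≤n⇒m<n∨m≡n j≤q
  ... | inj₂ refl = ⊤ , ∣⊤∣≡n (suc q) , ≤-reflexive (cong (suc q *_) (sumOver-⊤ f))
  ... | inj₁ j<q with q * f zero ≤? sum (f ∘ suc)
  ...   | yes head≤ with light-subset (f ∘ suc) j≤q
  ...     | S , ∣S∣≡j , S-light = inside ∷ S , cong suc ∣S∣≡j ,
    ≤-average-with-head q j (f zero) (sum (f ∘ suc)) (sumOver S (f ∘ suc))
      {{>-nonZero (<-≤-trans z<s j<q)}} j≤q head≤ S-light
  light-subset {suc q} f {suc j} (s≤s j≤q) | inj₁ j<q | no head≰ with light-subset (f ∘ suc) j<q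
  ...     | S , ∣S∣≡1+j , S-light = outside ∷ S , ∣S∣≡1+j ,
    ≤-average-without-head q (suc j) (f zero) (sum (f ∘ suc)) (sumOver S (f ∘ suc))
      {{>-nonZero (<-≤-trans z<s j<q)}} (<⇒≤ (≰⇒> head≰)) S-light

  ∃-subset-of-size : ∀ {m} (T : Subset m) {k} → k ≤ ∣ T ∣ → Σ[ U ∈ Subset m ] U ⊆ T × ∣ U ∣ ≡ k
  ∃-subset-of-size {m} T {zero} _ = ⊥ , ⊥⊆ , ∣⊥∣≡0 m
  ∃-subset-of-size (inside ∷ T) {suc k} (s≤s k≤∣T∣) with ∃-subset-of-size T k≤∣T∣
  ... | U , U⊆T , ∣U∣≡k = inside ∷ U , in⊆in U⊆T , cong suc ∣U∣≡k
  ∃-subset-of-size (outside ∷ T) {suc k} k<∣T∣ with ∃-subset-of-size T k<∣T∣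
  ... | U , U⊆T , ∣U∣≡1+k = outside ∷ U , out⊆ U⊆T , ∣U∣≡1+k

  ∣p∪q∣≤∣p∣+∣q∣ : ∀ {m} (p q : Subset m) → ∣ p ∪ q ∣ ≤ ∣ p ∣ + ∣ q ∣
  ∣p∪q∣≤∣p∣+∣q∣ []            []            = z≤n
  ∣p∪q∣≤∣p∣+∣q∣ (inside ∷ p)  (inside ∷ q)  = s≤s (≤-trans (∣p∪q∣≤∣p∣+∣q∣ p q) (+-monoʳ-≤ ∣ p ∣ (n≤1+n ∣ q ∣)))
  ∣p∪q∣≤∣p∣+∣q∣ (inside ∷ p)  (outside ∷ q) = s≤s (∣p∪q∣≤∣p∣+∣q∣ p q)
  ∣p∪q∣≤∣p∣+∣q∣ (outside ∷ p) (inside ∷ q)  = ≤-trans (s≤s (∣p∪q∣≤∣p∣+∣q∣ p q)) (≤-reflexive (sym (+-suc ∣ p ∣ ∣ q ∣)))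
  ∣p∪q∣≤∣p∣+∣q∣ (outside ∷ p) (outside ∷ q) = ∣p∪q∣≤∣p∣+∣q∣ p q

  ⋃[_]_ : ∀ {p m} → Subset p → (Fin p → Subset m) → Subset m
  ⋃[ [] ]          r = ⊥
  ⋃[ inside ∷ S ]  r = r zero ∪ ⋃[ S ] (r ∘ suc)
  ⋃[ outside ∷ S ] r = ⋃[ S ] (r ∘ suc)

  ∣⋃∣≤sumOver : ∀ {p m} (S : Subset p) (r : Fin p → Subset m) → ∣ ⋃[ S ] r ∣ ≤ sumOver S (∣_∣ ∘ r)
  ∣⋃∣≤sumOver {m = m} [] r = ≤-reflexive (∣⊥∣≡0 m)
  ∣⋃∣≤sumOver (inside ∷ S) r = ≤-trans (∣p∪q∣≤∣p∣+∣q∣ (r zero) (⋃[ S ] (r ∘ suc)))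
                                        (+-monoʳ-≤ ∣ r zero ∣ (∣⋃∣≤sumOver S (r ∘ suc)))
  ∣⋃∣≤sumOver (outside ∷ S) r = ∣⋃∣≤sumOver S (r ∘ suc)

  ∈⋃ : ∀ {p m} (S : Subset p) (r : Fin p → Subset m) {a b} → a ∈ S → b ∈ r a → b ∈ ⋃[ S ] r
  ∈⋃ (inside ∷ S)  r {zero}  here       b∈ra = p⊆p∪q (⋃[ S ] (r ∘ suc)) b∈ra
  ∈⋃ (inside ∷ S)  r {suc a} (there a∈S) b∈ra = q⊆p∪q (r zero) (⋃[ S ] (r ∘ suc)) (∈⋃ S (r ∘ suc) a∈S b∈ra)
  ∈⋃ (outside ∷ S) r {suc a} (there a∈S) b∈ra = ∈⋃ S (r ∘ suc) a∈S b∈ra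

  neighbours : ∀ {n} → BalancedBipartite n → Fin n → Subset n
  neighbours G a = tabulate (adj G a)

  -- edgeCount G is sum (degree G) by definition.
  degree : ∀ {n} → BalancedBipartite n → Fin n → ℕ
  degree G = ∣_∣ ∘ neighbours G

  independent-from-non-neighbours : ∀ {n} (G : BalancedBipartite n) (S U : Subset n) →
                                    U ⊆ ∁ (⋃[ S ] neighbours G) → Independent G S U
  independent-from-non-neighbours G S U U⊆ a b a∈S b∈U with adj G a b in ab
  ... | false = refl
  ... | true  = ⊥-elim (x∈∁p⇒x∉p (U⊆ b∈U) (∈⋃ S (neighbours G) a∈S b∈N[a]))
    where b∈N[a] = lookup⇒[]= b (neighbours G a) (trans (lookup∘tabulate (adj G a) b) ab)

  k[n+E]≤n²⇒k≤n : ∀ n k E .{{_ : NonZero n}} → k * (n + E) ≤ n * n → k ≤ n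
  k[n+E]≤n²⇒k≤n n k E k[n+E]≤n² = *-cancelʳ-≤ k n n (≤-trans (*-monoʳ-≤ k (m≤m+n n E)) k[n+E]≤n²)

  k[n+E]≤n²⇒k+s≤n : ∀ n k E s .{{_ : NonZero n}} → k * (n + E) ≤ n * n → n * s ≤ k * E → k + s ≤ n
  k[n+E]≤n²⇒k+s≤n n k E s k[n+E]≤n² ns≤kE = *-cancelˡ-≤ n (begin
    n * (k + s)       ≡⟨ *-distribˡ-+ n k s ⟩
    n * k + n * s     ≤⟨ +-monoʳ-≤ (n * k) ns≤kE ⟩
    n * k + k * E     ≡⟨ solve 3 (λ n k e → n :* k :+ k :* e := k :* (n :+ e)) refl n k E ⟩
    k * (n + E)       ≤⟨ k[n+E]≤n² ⟩
    n * n             ∎)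
    where open ≤-Reasoning

  k≤∣non-neighbours∣ : ∀ {n} .{{_ : NonZero n}} (G : BalancedBipartite n) k (S : Subset n) →
                       k * (n + edgeCount G) ≤ n * n → n * sumOver S (degree G) ≤ k * edgeCount G →
                       k ≤ ∣ ∁ (⋃[ S ] neighbours G) ∣
  k≤∣non-neighbours∣ {n} G k S k[n+E]≤n² S-light =
    subst (k ≤_) (sym (∣∁p∣≡n∸∣p∣ N)) (m+n≤o⇒m≤o∸n k k+∣N∣≤n)
    where
    N : Subset n
    N = ⋃[ S ] neighbours G
    k+∣N∣≤n : k + ∣ N ∣ ≤ n
    k+∣N∣≤n = ≤-trans (+-monoʳ-≤ k (∣⋃∣≤sumOver S (neighbours G)))
                      (k[n+E]≤n²⇒k+s≤n n k (edgeCount G) (sumOver S (degree G)) k[n+E]≤n² S-light)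

  bihole-of-order : ∀ {n} .{{_ : NonZero n}} (G : BalancedBipartite n) k →
                    k * (n + edgeCount G) ≤ n * n → Bihole G k
  bihole-of-order {n} G k k[n+E]≤n²
    with light-subset (degree G) (k[n+E]≤n²⇒k≤n n k (edgeCount G) k[n+E]≤n²)
  ... | S , ∣S∣≡k , S-light
    with ∃-subset-of-size (∁ (⋃[ S ] neighbours G)) (k≤∣non-neighbours∣ G k S k[n+E]≤n² S-light)
  ... | U , U⊆∁N , ∣U∣≡k = S , U , independent-from-non-neighbours G S U U⊆∁N , ∣S∣≡k , ∣U∣≡k

  m<[1+m/n]*n : ∀ m n .{{_ : NonZero n}} → m < suc (m / n) * n
  m<[1+m/n]*n m n = begin-strict
    m                    ≡⟨ m≡m%n+[m/n]*n m n ⟩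
    m % n + m / n * n    <⟨ +-monoˡ-< (m / n * n) (m%n<n m n) ⟩
    n + m / n * n        ∎
    where open ≤-Reasoning

module RationalBound where
  open import Data.Nat as ℕ using (ℕ; suc)
  open import Data.Integer as ℤ using (+_)
  import Data.Integer.Properties as ℤ
  import Data.Nat.Coprimality as Coprimality
  open import Data.Rational
  open import Data.Rational.Properties
  import Data.Rational.Solver as Solver
  open import Relation.Binary.PropositionalEquality
  open import Relation.Nullary.Decidable using (toWitness)
  open import Defs

  ℕtoℚ≡mkℚ : ∀ a → ℕtoℚ a ≡ mkℚ (+ a) 0 (Coprimality.sym (Coprimality.1-coprimeTo a))
  ℕtoℚ≡mkℚ a = normalize-coprime (Coprimality.sym (Coprimality.1-coprimeTo a))

  ℕtoℚ-+ : ∀ a b → ℕtoℚ (a ℕ.+ b) ≡ ℕtoℚ a + ℕtoℚ b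
  ℕtoℚ-+ a b = begin
    + (a ℕ.+ b) / 1                      ≡⟨ cong (_/ 1) (ℤ.pos-+ a b) ⟩
    (+ a ℤ.+ + b) / 1                    ≡⟨ cong (_/ 1) (sym (cong₂ ℤ._+_ (ℤ.*-identityʳ (+ a)) (ℤ.*-identityʳ (+ b)))) ⟩
    (+ a ℤ.* + 1 ℤ.+ + b ℤ.* + 1) / 1    ≡⟨ sym (cong₂ _+_ (ℕtoℚ≡mkℚ a) (ℕtoℚ≡mkℚ b)) ⟩
    ℕtoℚ a + ℕtoℚ b                      ∎
    where open ≡-Reasoning

  ℕtoℚ-* : ∀ a b → ℕtoℚ (a ℕ.* b) ≡ ℕtoℚ a * ℕtoℚ b
  ℕtoℚ-* a b = trans (cong (_/ 1) (ℤ.pos-* a b)) (sym (cong₂ _*_ (ℕtoℚ≡mkℚ a) (ℕtoℚ≡mkℚ b)))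

  ℕtoℚ-mono-≤ : ∀ {a b} → a ℕ.≤ b → ℕtoℚ a ≤ ℕtoℚ b
  ℕtoℚ-mono-≤ {a} {b} a≤b rewrite ℕtoℚ≡mkℚ a | ℕtoℚ≡mkℚ b =
    *≤* (subst₂ ℤ._≤_ (sym (ℤ.*-identityʳ (+ a))) (sym (ℤ.*-identityʳ (+ b))) (ℤ.+≤+ a≤b))

  ℕtoℚ-mono-< : ∀ {a b} → a ℕ.< b → ℕtoℚ a < ℕtoℚ b
  ℕtoℚ-mono-< {a} {b} a<b rewrite ℕtoℚ≡mkℚ a | ℕtoℚ≡mkℚ b =
    *<* (subst₂ ℤ._<_ (sym (ℤ.*-identityʳ (+ a))) (sym (ℤ.*-identityʳ (+ b))) (ℤ.+<+ a<b))

  ℕtoℚ-nonNeg : ∀ a → NonNegative (ℕtoℚ a)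
  ℕtoℚ-nonNeg a = nonNegative (ℕtoℚ-mono-≤ {0} {a} ℕ.z≤n)

  n<m[d+1] : ∀ d n m E → n ℕ.* n ℕ.< m ℕ.* (n ℕ.+ E) → ℕtoℚ E ≤ d * ℕtoℚ n →
             ℕtoℚ n < ℕtoℚ m * (d + 1ℚ)
  n<m[d+1] d n m E n²<m[n+E] E≤dn = *-cancelʳ-<-nonNeg N (begin-strict
      N * N                   ≡⟨ sym (ℕtoℚ-* n n) ⟩
      ℕtoℚ (n ℕ.* n)          <⟨ ℕtoℚ-mono-< n²<m[n+E] ⟩
      ℕtoℚ (m ℕ.* (n ℕ.+ E))  ≡⟨ trans (ℕtoℚ-* m (n ℕ.+ E)) (cong (M *_) (ℕtoℚ-+ n E)) ⟩
      M * (N + ℕtoℚ E)        ≤⟨ *-monoˡ-≤-nonNeg M (+-monoʳ-≤ N E≤dn) ⟩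
      M * (N + d * N)         ≡⟨ solve 3 (λ m d n → m :* (n :+ d :* n) := (m :* (d :+ con 1ℚ)) :* n) refl M d N ⟩
      M * (d + 1ℚ) * N        ∎)
    where
    open ≤-Reasoning
    open Solver.+-*-Solver
    N M : ℚ
    N = ℕtoℚ n
    M = ℕtoℚ m
    instance
      _ : NonNegative N
      _ = ℕtoℚ-nonNeg n
      _ : NonNegative M
      _ = ℕtoℚ-nonNeg m

  bound≤ : ∀ d (0≤d : 0ℚ ≤ d) n k → ℕtoℚ n < ℕtoℚ (suc k) * (d + 1ℚ) → bound n d 0≤d ≤ ℕtoℚ k
  bound≤ d 0≤d n k n<[k+1][d+1] = begin
      N * (1/ (d + 1ℚ)) - ℕtoℚ 2   ≤⟨ +-monoˡ-≤ (- ℕtoℚ 2) n/[d+1]≤k+1 ⟩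
      ℕtoℚ (suc k) - ℕtoℚ 2        ≡⟨ cong (_- ℕtoℚ 2) (ℕtoℚ-+ 1 k) ⟩
      (1ℚ + K) - ℕtoℚ 2            ≡⟨ solve 1 (λ k → (con 1ℚ :+ k) :- (con 1ℚ :+ con 1ℚ) := k :+ :- con 1ℚ) refl K ⟩
      K + - 1ℚ                     ≤⟨ +-monoʳ-≤ K (toWitness {a? = - 1ℚ ≤? 0ℚ} _) ⟩
      K + 0ℚ                       ≡⟨ +-identityʳ K ⟩
      K                            ∎
    where
    open ≤-Reasoning
    open Solver.+-*-Solver
    N K : ℚ
    N = ℕtoℚ n
    K = ℕtoℚ k
    instance
      _ : NonNegative d
      _ = nonNegative 0≤d
      d+1-pos : Positive (d + 1ℚ)
      d+1-pos = nonNeg+pos⇒pos d 1ℚ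
      d+1≢0 : NonZero (d + 1ℚ)
      d+1≢0 = pos⇒nonZero (d + 1ℚ)
      _ : NonNegative (1/ (d + 1ℚ))
      _ = pos⇒nonNeg (1/ (d + 1ℚ)) {{1/pos⇒pos (d + 1ℚ)}}
    n/[d+1]≤k+1 : N * (1/ (d + 1ℚ)) ≤ ℕtoℚ (suc k)
    n/[d+1]≤k+1 = begin
      N * (1/ (d + 1ℚ))                        ≤⟨ *-monoʳ-≤-nonNeg (1/ (d + 1ℚ)) (<⇒≤ n<[k+1][d+1]) ⟩
      ℕtoℚ (suc k) * (d + 1ℚ) * (1/ (d + 1ℚ))  ≡⟨ *-assoc (ℕtoℚ (suc k)) (d + 1ℚ) (1/ (d + 1ℚ)) ⟩
      ℕtoℚ (suc k) * ((d + 1ℚ) * (1/ (d + 1ℚ))) ≡⟨ cong (ℕtoℚ (suc k) *_) (*-inverseʳ (d + 1ℚ)) ⟩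
      ℕtoℚ (suc k) * 1ℚ                        ≡⟨ *-identityʳ (ℕtoℚ (suc k)) ⟩
      ℕtoℚ (suc k)                             ∎

open import Defs
open import Data.Nat using (ℕ; NonZero)
open import Data.Rational using (ℚ; 0ℚ; _≤_; _*_)
import Data.Nat as ℕ
open import Data.Nat.Properties using (≤-trans; m≤m+n)
open import Data.Product using (_,_)
open import Data.Nat.DivMod using (_/_; m/n*n≤m)
open Counting
open RationalBound

theorem2 : (d : ℚ) (0≤d : 0ℚ ≤ d) (n : ℕ) → .{{_ : NonZero n}} →
    (G : BalancedBipartite n) → ℕtoℚ (edgeCount G) ≤ d * ℕtoℚ n →
    αtilde≥ G (bound n d 0≤d)
theorem2 d 0≤d n G E≤dn =
    k , bihole-of-order G k (m/n*n≤m (n ℕ.* n) (n ℕ.+ E))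
      , bound≤ d 0≤d n k (n<m[d+1] d n (ℕ.suc k) E (m<[1+m/n]*n (n ℕ.* n) (n ℕ.+ E)) E≤dn)
  where
  E : ℕ
  E = edgeCount G
  instance
    n+E≢0 : NonZero (n ℕ.+ E)
    n+E≢0 = ℕ.>-nonZero (≤-trans (ℕ.>-nonZero⁻¹ n) (m≤m+n n E))
  k : ℕ
  k = (n ℕ.* n) / (n ℕ.+ E)
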